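{- For every integer $n\ge 1$, $\operatorname{tw}(F_2(S_n)) = n-1$, where $S_n$ is the star with center $0$ and leaves $1,\dots,n$.
   Context: For a graph $G$, the $2$-token graph $F_2(G)$ has as vertices the $2$-element subsets of $V(G)$, two being adjacent when their symmetric difference is an edge of $G$. $\operatorname{tw}$ denotes treewidth (minimum over tree decompositions of the maximum bag size minus one). The star $S_n=K_{1,n}$ has vertex set $\{0\}\cup[n]$ with center $0$. -}

module Defs where

open import Data.Nat using (ℕ; zero; suc; _≤_; _<_)
open import Data.Fin using (Fin; toℕ) renaming (zero to fzero; suc to fsuc)
open import Data.Fin.Base using (_<_)
open import Data.Product using (Σ; ∃; _×_; _,_)
open import Data.Sum using (_⊎_)
open import Data.List using (List; length)
open import Data.List.Membership.Propositional using (_∈_)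
open import Relation.Binary.PropositionalEquality using (_≡_)
open import Relation.Nullary using (¬_)

record Graph (V : Set) : Set₁ where
  field
    Adj   : V → V → Set
    sym   : ∀ {u v} → Adj u v → Adj v u
    irrefl : ∀ {v} → ¬ Adj v v
open Graph public

data StarAdj {n : ℕ} : Fin (suc n) → Fin (suc n) → Set where
  c-l : (i : Fin n) → StarAdj fzero (fsuc i)
  l-c : (i : Fin n) → StarAdj (fsuc i) fzero

Star : (n : ℕ) → Graph (Fin (suc n))
Star n = record { Adj = StarAdj ; sym = s ; irrefl = λ () }
  where
  s : ∀ {u v} → StarAdj u v → StarAdj v u
  s (c-l i) = l-c i
  s (l-c i) = c-l i

-- The 2-token graph F_2(G) for G on Fin m.
-- Vertices: 2-element subsets {a,b}, represented as pairs with a < b.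

Pair : ℕ → Set
Pair m = Σ (Fin m) λ a → Σ (Fin m) λ b → a Data.Fin.Base.< b

_∈₂_ : ∀ {m} → Fin m → Pair m → Set
x ∈₂ (a , b , _) = (x ≡ a) ⊎ (x ≡ b)

SymDiffIs : ∀ {m} → Pair m → Pair m → Fin m → Fin m → Set
SymDiffIs {m} A B x y =
  ¬ (x ≡ y) ×
  (∀ z → ((z ∈₂ A × ¬ z ∈₂ B) ⊎ (z ∈₂ B × ¬ z ∈₂ A)) → (z ≡ x) ⊎ (z ≡ y)) ×
  ((x ∈₂ A × ¬ x ∈₂ B) ⊎ (x ∈₂ B × ¬ x ∈₂ A)) ×
  ((y ∈₂ A × ¬ y ∈₂ B) ⊎ (y ∈₂ B × ¬ y ∈₂ A))

TokAdj : ∀ {m} → Graph (Fin m) → Pair m → Pair m → Set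
TokAdj G A B = ∃ λ x → ∃ λ y → SymDiffIs A B x y × Adj G x y

-- Trees, represented by a parent function: node fsuc i of a tree on
-- Fin (suc t) has parent `parent i` with toℕ (parent i) ≤ toℕ i
-- (i.e. parent index strictly smaller than fsuc i).  Every finite tree
-- admits such a labelling (BFS order from any root).

record Tree : Set where
  field
    size   : ℕ                          -- number of nodes minus one
    parent : (i : Fin size) → Fin (suc size)
    parent< : (i : Fin size) → toℕ (parent i) ≤ toℕ i
open Tree public

Node : Tree → Set
Node T = Fin (suc (size T))

data TreeAdj (T : Tree) : Node T → Node T → Set where
  up   : (i : Fin (size T)) → TreeAdj T (fsuc i) (parent T i)
  down : (i : Fin (size T)) → TreeAdj T (parent T i) (fsuc i)

data WalkIn (T : Tree) (P : Node T → Set) : Node T → Node T → Set where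
  here : ∀ {i} → P i → WalkIn T P i i
  step : ∀ {i j k} → P i → TreeAdj T i j → WalkIn T P j k → WalkIn T P i k

record TreeDecomposition {V : Set} (G : Graph V) : Set₁ where
  field
    tree : Tree
    bag  : Node tree → List V
    vertexCover : ∀ v → ∃ λ i → v ∈ bag i
    edgeCover   : ∀ u v → Adj G u v → ∃ λ i → (u ∈ bag i) × (v ∈ bag i)
    connected   : ∀ v i j → v ∈ bag i → v ∈ bag j →
                  WalkIn tree (λ k → v ∈ bag k) i j
open TreeDecomposition public

HasWidth≤ : ∀ {V} {G : Graph V} → TreeDecomposition G → ℕ → Set
HasWidth≤ D k = ∀ i → length (bag D i) ≤ suc k

Treewidth≡ : ∀ {V} → Graph V → ℕ → Set₁
Treewidth≡ G k =
  (∃ λ (D : TreeDecomposition G) → HasWidth≤ D k) ×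
  (∀ (D : TreeDecomposition G) → ∃ λ i → suc k ≤ length (bag D i))

private
  swapX : ∀ {m} {A B : Pair m} {z : Fin m} →
          ((z ∈₂ A × ¬ z ∈₂ B) ⊎ (z ∈₂ B × ¬ z ∈₂ A)) →
          ((z ∈₂ B × ¬ z ∈₂ A) ⊎ (z ∈₂ A × ¬ z ∈₂ B))
  swapX {A = A} {B} (Data.Sum.inj₁ p) = Data.Sum.inj₂ p
  swapX {A = A} {B} (Data.Sum.inj₂ p) = Data.Sum.inj₁ p

  tokSym : ∀ {m} {G : Graph (Fin m)} {A B} → TokAdj G A B → TokAdj G B A
  tokSym {A = A} {B} (x , y , (ne , cl , px , py) , e) =
    x , y , (ne , (λ z h → cl z (swapX {A = B} {A} h)) , swapX {A = A} {B} px , swapX {A = A} {B} py) , e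

  tokIrr : ∀ {m} {G : Graph (Fin m)} {A} → ¬ TokAdj G A A
  tokIrr (x , y , (ne , cl , Data.Sum.inj₁ (p , q) , py) , e) = q p
  tokIrr (x , y , (ne , cl , Data.Sum.inj₂ (p , q) , py) , e) = q p

F₂ : ∀ {m} → Graph (Fin m) → Graph (Pair m)
F₂ G = record { Adj = TokAdj G ; sym = λ {A} {B} → tokSym {G = G} {A} {B} ; irrefl = λ {A} → tokIrr {G = G} {A} }

-- F₂(Sₙ) is Kₙ with every edge subdivided: the token {a,b} with 0 < a < b is adjacent exactly to
-- the hubs {0,a} and {0,b}.  Upper bound: one bag holding the n hubs, and a bag {{0,a},{0,b},{a,b}}
-- for each other token; for n = 2 these triangles are too large, but F₂(S₂) is a path.
-- Lower bound: for each leaf i, the nodes whose bag holds a token with larger element i form a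
-- subtree (every such token shares a bag with the hub {0,i}), and any two of these subtrees meet
-- (at a bag covering the edge {0,i} – {i,j}).  By the Helly property of subtrees, one bag meets all
-- n of them, so it holds n tokens with distinct larger elements.
module Submission where

open import Defs hiding (sym)
open import Data.Nat as ℕ using (ℕ; zero; suc; _∸_; _≤_; z≤n; s≤s; _*_)
import Data.Nat.Properties as ℕ
open import Data.Fin as Fin using (Fin; toℕ; _≟_; remQuot; combine; _<?_) renaming (zero to fzero; suc to fsuc)
import Data.Fin.Properties as Fin
open import Data.Product using (∃; _×_; _,_; proj₁; proj₂; uncurry)
open import Data.Sum using (_⊎_; inj₁; inj₂; [_,_]; swap)
open import Data.Empty using (⊥; ⊥-elim)
open import Data.List using (List; []; _∷_; length; lookup; tabulate; allFin; filter)
open import Data.List.Relation.Unary.Any using (Any; here; there; any?; index)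
open import Data.List.Relation.Unary.Any.Properties using (lookup-index)
open import Data.List.Relation.Unary.All as All using (All)
open import Data.List.Relation.Unary.All.Properties using (all-filter)
open import Data.List.Membership.Propositional using (_∈_; lose; find)
open import Data.List.Membership.Propositional.Properties using (∈-allFin; ∈-filter⁺; ∈-tabulate⁺)
open import Data.List.Properties using (length-tabulate)
open import Data.List.Extrema.Nat using (argmin; argmax; argmin-all; f[argmin]≤f[xs]; f[xs]≤f[argmax])
open import Relation.Nullary using (¬_; yes; no)
open import Relation.Unary using (Decidable)
open import Relation.Binary using (tri<; tri≈; tri>)
open import Relation.Binary.PropositionalEquality using (_≡_; _≢_; refl; sym; trans; cong; subst; module ≡-Reasoning)
open import Function using (_∘_)
open import Function.Definitions using (Injective)

least-satisfier : ∀ {n} {P : Fin n → Set} → Decidable P → ∀ {x} → P x →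
                  ∃ λ r → P r × (∀ {y} → P y → toℕ r ≤ toℕ y)
least-satisfier {P = P} P? {x} px =
  argmin toℕ x satisfiers ,
  argmin-all toℕ px (all-filter P? (allFin _)) ,
  λ {y} py → All.lookup (f[argmin]≤f[xs] x satisfiers) (∈-filter⁺ P? (∈-allFin y) py)
  where
  satisfiers : List (Fin _)
  satisfiers = filter P? (allFin _)

maximiser : ∀ {n} (f : Fin (suc n) → ℕ) → ∃ λ i* → ∀ i → f i ≤ f i*
maximiser f =
  argmax f fzero (allFin _) , λ i → All.lookup (f[xs]≤f[argmax] {f = f} fzero (allFin _)) (∈-allFin i)

module _ {T : Tree} where

  walk-source : ∀ {P i j} → WalkIn T P i j → P i
  walk-source (here p)     = p
  walk-source (step p _ _) = p

  walk-++ : ∀ {P i j k} → WalkIn T P i j → WalkIn T P j k → WalkIn T P i k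
  walk-++ (here _)     w′ = w′
  walk-++ (step p a w) w′ = step p a (walk-++ w w′)

  walk-map : ∀ {P Q : Node T → Set} → (∀ {k} → P k → Q k) →
             ∀ {i j} → WalkIn T P i j → WalkIn T Q i j
  walk-map f (here p)     = here (f p)
  walk-map f (step p a w) = step (f p) a (walk-map f w)

module _ (T : Tree) where

  data InSubtree (t : Node T) : Node T → Set where
    self  : InSubtree t t
    child : (u : Fin (size T)) → InSubtree t (parent T u) → InSubtree t (fsuc u)

  inSubtree⇒toℕ≤ : ∀ {t x} → InSubtree t x → toℕ t ≤ toℕ x
  inSubtree⇒toℕ≤ self        = ℕ.≤-refl
  inSubtree⇒toℕ≤ (child u d) = ℕ.≤-trans (inSubtree⇒toℕ≤ d) (ℕ.m≤n⇒m≤1+n (parent< T u))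

  inSubtree∧toℕ≤⇒≡ : ∀ {t x} → InSubtree t x → toℕ x ≤ toℕ t → x ≡ t
  inSubtree∧toℕ≤⇒≡ self        _    = refl
  inSubtree∧toℕ≤⇒≡ (child u d) x≤t =
    ⊥-elim (ℕ.1+n≰n (ℕ.≤-trans x≤t (ℕ.≤-trans (inSubtree⇒toℕ≤ d) (parent< T u))))

  IsConnected : (Node T → Set) → Set
  IsConnected U = ∀ a b → U a → U b → WalkIn T U a b

  ParentEdgeIn : (Node T → Set) → Node T → Set
  ParentEdgeIn P t = P t × ∃ λ u → t ≡ fsuc u × P (parent T u)

  walk-stays-or-exits : ∀ {P t i j} → WalkIn T P i j → InSubtree t i →
                        InSubtree t j ⊎ ParentEdgeIn P t
  walk-stays-or-exits (here _)              d           = inj₁ d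
  walk-stays-or-exits (step _ (down u) w)   d           = walk-stays-or-exits w (child u d)
  walk-stays-or-exits (step p (up u) w)     self        = inj₂ (p , u , refl , walk-source w)
  walk-stays-or-exits (step _ (up u) w)     (child _ d) = walk-stays-or-exits w d

  connected⇒has-root : ∀ {U} → Decidable U → IsConnected U → ∀ {x} → U x →
                       ∃ λ r → U r × (∀ y → U y → InSubtree r y)
  connected⇒has-root {U} U? conn ux with least-satisfier U? ux
  ... | r , ur , minimal = r , ur , below
    where
    below : ∀ y → U y → InSubtree r y
    below y uy with walk-stays-or-exits (conn r y ur uy) self
    ... | inj₁ d = d
    ... | inj₂ (_ , u , refl , parent∈U) =
      ⊥-elim (ℕ.1+n≰n (ℕ.≤-trans (minimal parent∈U) (parent< T u)))

  -- A common point of U i and U i* lies in the subtree of root i*, while root i, having a smaller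
  -- index, is either root i* itself or outside that subtree; a walk inside U i between the two then
  -- passes through root i*.
  maximal-root-in-all : ∀ {k} (U : Fin k → Node T → Set) → (∀ i → IsConnected (U i)) →
                        (∀ i j → ∃ λ x → U i x × U j x) →
                        (root : Fin k → Node T) → (∀ i → U i (root i)) →
                        (∀ i {y} → U i y → InSubtree (root i) y) →
                        ∀ {i*} → (∀ i → toℕ (root i) ≤ toℕ (root i*)) → ∀ i → U i (root i*)
  maximal-root-in-all U conn meet root in-root below {i*} maximal i with meet i i*
  ... | x , uix , ui*x with walk-stays-or-exits (conn i x (root i) uix (in-root i)) (below i* ui*x)
  ... | inj₁ d        = subst (U i) (inSubtree∧toℕ≤⇒≡ d (maximal i)) (in-root i)
  ... | inj₂ (ui , _) = ui

  helly : ∀ {k} (U : Fin k → Node T → Set) → (∀ i → Decidable (U i)) → (∀ i → IsConnected (U i)) →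
          (∀ i j → ∃ λ x → U i x × U j x) → ∃ λ t → ∀ i → U i t
  helly {zero}  U U? conn meet = fzero , λ ()
  helly {suc k} U U? conn meet =
    root i* , maximal-root-in-all U conn meet root (λ i → proj₁ (proj₂ (rooted i)))
                                  (λ i → proj₂ (proj₂ (rooted i)) _) maximal
    where
    rooted : ∀ i → ∃ λ r → U i r × (∀ y → U i y → InSubtree r y)
    rooted i = connected⇒has-root (U? i) (conn i) (proj₁ (proj₂ (meet i i)))
    root : Fin (suc k) → Node T
    root i = proj₁ (rooted i)
    i* : Fin (suc k)
    i* = proj₁ (maximiser (λ i → toℕ (root i)))
    maximal : ∀ i → toℕ (root i) ≤ toℕ (root i*)
    maximal = proj₂ (maximiser (λ i → toℕ (root i)))

injection-into-list⇒≤length : ∀ {A B : Set} {k} {xs : List A} (f : A → B) (g : Fin k → B) →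
                              Injective _≡_ _≡_ g → (∀ i → Any (λ x → f x ≡ g i) xs) → k ≤ length xs
injection-into-list⇒≤length {xs = xs} f g g-injective witness = ℕ.≮⇒≥ λ short →
  let i , j , i<j , same-position = Fin.pigeonhole short position
  in Fin.<⇒≢ i<j (g-injective (begin
    g i                          ≡⟨ sym (lookup-index (witness i)) ⟩
    f (lookup xs (position i))   ≡⟨ cong (λ p → f (lookup xs p)) same-position ⟩
    f (lookup xs (position j))   ≡⟨ lookup-index (witness j) ⟩
    g j                          ∎))
  where
  open ≡-Reasoning
  position : Fin _ → Fin (length xs)
  position i = index (witness i)

three-distinct-⊈-pair : ∀ {A : Set} {p q r x y : A} → p ≢ q → p ≢ r → q ≢ r →
                        p ≡ x ⊎ p ≡ y → q ≡ x ⊎ q ≡ y → r ≡ x ⊎ r ≡ y → ⊥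
three-distinct-⊈-pair p≢q _   _   (inj₁ refl) (inj₁ refl) _           = p≢q refl
three-distinct-⊈-pair _   p≢r _   (inj₁ refl) (inj₂ refl) (inj₁ refl) = p≢r refl
three-distinct-⊈-pair _   _   q≢r (inj₁ refl) (inj₂ refl) (inj₂ refl) = q≢r refl
three-distinct-⊈-pair p≢q _   _   (inj₂ refl) (inj₂ refl) _           = p≢q refl
three-distinct-⊈-pair _   _   q≢r (inj₂ refl) (inj₁ refl) (inj₁ refl) = q≢r refl
three-distinct-⊈-pair _   p≢r _   (inj₂ refl) (inj₁ refl) (inj₂ refl) = p≢r refl

_∈_△_ : ∀ {m} → Fin m → Pair m → Pair m → Set
z ∈ A △ B = (z ∈₂ A × ¬ z ∈₂ B) ⊎ (z ∈₂ B × ¬ z ∈₂ A)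

∈-both⇒∉△ : ∀ {m} {z : Fin m} {A B} → z ∈₂ A → z ∈₂ B → ¬ z ∈ A △ B
∈-both⇒∉△ _   z∈B (inj₁ (_ , z∉B)) = z∉B z∈B
∈-both⇒∉△ z∈A _   (inj₂ (_ , z∉A)) = z∉A z∈A

∉-both⇒∉△ : ∀ {m} {z : Fin m} {A B} → ¬ z ∈₂ A → ¬ z ∈₂ B → ¬ z ∈ A △ B
∉-both⇒∉△ z∉A _   (inj₁ (z∈A , _)) = z∉A z∈A
∉-both⇒∉△ _   z∉B (inj₂ (z∈B , _)) = z∉B z∈B

larger : ∀ {m} → Pair m → Fin m
larger (_ , b , _) = b

record _≐[_,_] {m} (A : Pair m) (x z : Fin m) : Set where
  constructor ≐⟨_,_,_⟩
  field
    first∈  : x ∈₂ A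
    second∈ : z ∈₂ A
    only    : ∀ {w} → w ∈₂ A → w ≡ x ⊎ w ≡ z

≐-components : ∀ {m} (A : Pair m) → A ≐[ proj₁ A , larger A ]
≐-components _ = ≐⟨ inj₁ refl , inj₂ refl , (λ w∈ → w∈) ⟩

≐-swap : ∀ {m} {A : Pair m} {x z} → A ≐[ x , z ] → A ≐[ z , x ]
≐-swap ≐⟨ x∈A , z∈A , A⊆ ⟩ = ≐⟨ z∈A , x∈A , (λ w∈A → swap (A⊆ w∈A)) ⟩

symDiff-of-shared : ∀ {m} {A B : Pair m} {x y z} → x ≢ y → x ≢ z → y ≢ z →
                    A ≐[ x , z ] → B ≐[ y , z ] → SymDiffIs A B x y
symDiff-of-shared {A = A} {B} {x} {y} x≢y x≢z y≢z ≐⟨ x∈A , z∈A , A⊆ ⟩ ≐⟨ y∈B , z∈B , B⊆ ⟩ =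
  x≢y , closed , inj₁ (x∈A , x∉B) , inj₂ (y∈B , y∉A)
  where
  x∉B : ¬ x ∈₂ B
  x∉B x∈B = [ x≢y , x≢z ] (B⊆ x∈B)
  y∉A : ¬ y ∈₂ A
  y∉A y∈A = [ x≢y ∘ sym , y≢z ] (A⊆ y∈A)
  closed : ∀ w → w ∈ A △ B → w ≡ x ⊎ w ≡ y
  closed w (inj₁ (w∈A , w∉B)) with A⊆ w∈A
  ... | inj₁ w≡x = inj₁ w≡x
  ... | inj₂ refl = ⊥-elim (w∉B z∈B)
  closed w (inj₂ (w∈B , w∉A)) with B⊆ w∈B
  ... | inj₁ w≡y = inj₂ w≡y
  ... | inj₂ refl = ⊥-elim (w∉A z∈A)

hub : ∀ {n} → Fin n → Pair (suc n)
hub i = fzero , fsuc i , s≤s z≤n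

data SubdivisionEdge {n} : Pair (suc n) → Pair (suc n) → Set where
  to-low  : (a b : Fin n) (a<b : fsuc a Fin.< fsuc b) →
            SubdivisionEdge (fsuc a , fsuc b , a<b) (hub a)
  to-high : (a b : Fin n) (a<b : fsuc a Fin.< fsuc b) →
            SubdivisionEdge (fsuc a , fsuc b , a<b) (hub b)

subdivisionEdge⇒tokAdj : ∀ {n u v} → SubdivisionEdge {n} u v → TokAdj (Star n) u v
subdivisionEdge⇒tokAdj (to-low a b a<b) =
  fsuc b , fzero ,
  symDiff-of-shared (λ ()) (λ b≡a → Fin.<⇒≢ a<b (sym b≡a)) (λ ())
    (≐-swap (≐-components (fsuc a , fsuc b , a<b))) (≐-components (hub a)) ,
  l-c b
subdivisionEdge⇒tokAdj (to-high a b a<b) =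
  fsuc a , fzero ,
  symDiff-of-shared (λ ()) (Fin.<⇒≢ a<b) (λ ())
    (≐-components (fsuc a , fsuc b , a<b)) (≐-components (hub b)) ,
  l-c a

-- Every edge of the star has the centre as an endpoint.
centre∈△ : ∀ {n A B} → TokAdj (Star n) A B → fzero ∈ A △ B
centre∈△ (_ , _ , (_ , _ , x∈△ , _) , c-l _) = x∈△
centre∈△ (_ , _ , (_ , _ , _ , y∈△) , l-c _) = y∈△

-- If c is neither a nor b, then 0, c+1 and a+1 are three distinct points of the two-element set A △ B.
tokAdj-hub⇒subdivisionEdge : ∀ {n} {a b c : Fin n} {a<b} →
                             TokAdj (Star n) (fsuc a , fsuc b , a<b) (hub c) →
                             SubdivisionEdge (fsuc a , fsuc b , a<b) (hub c)
tokAdj-hub⇒subdivisionEdge {a = a} {b} {c} {a<b} (_ , _ , (_ , closed , _) , _) with c ≟ a | c ≟ b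
... | yes refl | _        = to-low a b a<b
... | no _     | yes refl = to-high a b a<b
... | no c≢a   | no c≢b   =
  ⊥-elim (three-distinct-⊈-pair (λ ()) (λ ()) 1+c≢1+a
           (closed fzero (inj₂ (inj₁ refl , λ { (inj₁ ()) ; (inj₂ ()) })))
           (closed (fsuc c) (inj₂ (inj₂ refl , [ 1+c≢1+a , 1+c≢1+b ])))
           (closed (fsuc a) (inj₁ (inj₁ refl , λ { (inj₁ ()) ; (inj₂ e) → 1+c≢1+a (sym e) }))))
  where
  1+c≢1+a : fsuc c ≢ fsuc a
  1+c≢1+a e = c≢a (Fin.suc-injective e)
  1+c≢1+b : fsuc c ≢ fsuc b
  1+c≢1+b e = c≢b (Fin.suc-injective e)

tokAdj⇒subdivisionEdge : ∀ {n} u v → TokAdj (Star n) u v → SubdivisionEdge u v ⊎ SubdivisionEdge v u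
tokAdj⇒subdivisionEdge (_ , fzero , ()) _ _
tokAdj⇒subdivisionEdge _ (_ , fzero , ()) _
tokAdj⇒subdivisionEdge u@(fzero , fsuc _ , _) v@(fzero , fsuc _ , _) adj =
  ⊥-elim (∈-both⇒∉△ {A = u} {v} (inj₁ refl) (inj₁ refl) (centre∈△ {A = u} {v} adj))
tokAdj⇒subdivisionEdge u@(fsuc _ , fsuc _ , _) v@(fsuc _ , fsuc _ , _) adj =
  ⊥-elim (∉-both⇒∉△ {A = u} {v} [ (λ ()) , (λ ()) ] [ (λ ()) , (λ ()) ] (centre∈△ {A = u} {v} adj))
tokAdj⇒subdivisionEdge (fsuc _ , fsuc _ , _) (fzero , fsuc _ , s≤s z≤n) adj =
  inj₁ (tokAdj-hub⇒subdivisionEdge adj)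
tokAdj⇒subdivisionEdge {n} u@(fzero , fsuc _ , s≤s z≤n) v@(fsuc _ , fsuc _ , _) adj =
  inj₂ (tokAdj-hub⇒subdivisionEdge (Graph.sym (F₂ (Star n)) {u} {v} adj))

starTree : ℕ → Tree
starTree k = record { size = k ; parent = λ _ → fzero ; parent< = λ _ → z≤n }

starDecomposition : ∀ {V} {G : Graph V} {k} (bags : Fin (suc k) → List V) →
                    (∀ v → ∃ λ i → v ∈ bags i) →
                    (∀ u v → Adj G u v → ∃ λ i → u ∈ bags i × v ∈ bags i) →
                    (∀ {v} i j → v ∈ bags (fsuc i) → v ∈ bags (fsuc j) → v ∈ bags fzero ⊎ i ≡ j) →
                    TreeDecomposition G
starDecomposition {k = k} bags cover edges leaves = record
  { tree = starTree k ; bag = bags ; vertexCover = cover ; edgeCover = edges ; connected = walk }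
  where
  walk : ∀ v i j → v ∈ bags i → v ∈ bags j → WalkIn (starTree k) (λ l → v ∈ bags l) i j
  walk v fzero    fzero    v∈i _   = here v∈i
  walk v fzero    (fsuc j) v∈i v∈j = step v∈i (down j) (here v∈j)
  walk v (fsuc i) fzero    v∈i v∈j = step v∈i (up i) (here v∈j)
  walk v (fsuc i) (fsuc j) v∈i v∈j with leaves i j v∈i v∈j
  ... | inj₁ v∈root = step v∈i (up i) (step v∈root (down j) (here v∈j))
  ... | inj₂ refl   = here v∈i

subdivisionEdges-cover⇒edgeCover : ∀ {n} {I : Set} (bags : I → List (Pair (suc n))) →
                                   (∀ {u v} → SubdivisionEdge u v → ∃ λ i → u ∈ bags i × v ∈ bags i) →
                                   ∀ u v → TokAdj (Star n) u v → ∃ λ i → u ∈ bags i × v ∈ bags i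
subdivisionEdges-cover⇒edgeCover bags cover u v adj with tokAdj⇒subdivisionEdge u v adj
... | inj₁ e = cover e
... | inj₂ e = let i , v∈ , u∈ = cover e in i , u∈ , v∈

-- Leaves are indexed by all (x , y) : Fin (suc n) × Fin (suc n) through combine; those with
-- ¬ (0 < x < y) get an empty bag.
module HubDecomposition (n : ℕ) where

  hubs : List (Pair (suc n))
  hubs = tabulate hub

  triangle : Fin (suc n) → Fin (suc n) → List (Pair (suc n))
  triangle (fsuc a) (fsuc b) with fsuc a <? fsuc b
  ... | yes a<b = hub a ∷ hub b ∷ (fsuc a , fsuc b , a<b) ∷ []
  ... | no  _   = []
  triangle _ _ = []

  bags : Fin (suc (suc n * suc n)) → List (Pair (suc n))
  bags fzero    = hubs
  bags (fsuc k) = uncurry triangle (remQuot (suc n) k)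

  slot : ∀ {a b : Fin n} → fsuc a Fin.< fsuc b → Fin (suc (suc n * suc n))
  slot {a} {b} _ = fsuc (combine (fsuc a) (fsuc b))

  triangle-contents : ∀ {a b} (a<b : fsuc a Fin.< fsuc b) →
                      triangle (fsuc a) (fsuc b) ≡ hub a ∷ hub b ∷ (fsuc a , fsuc b , a<b) ∷ []
  triangle-contents {a} {b} a<b with fsuc a <? fsuc b
  ... | yes a<b′ = cong (λ p → hub a ∷ hub b ∷ (fsuc a , fsuc b , p) ∷ []) (Fin.<-irrelevant a<b′ a<b)
  ... | no ¬a<b  = ⊥-elim (¬a<b a<b)

  bags-slot : ∀ {a b} (a<b : fsuc a Fin.< fsuc b) →
              bags (slot a<b) ≡ hub a ∷ hub b ∷ (fsuc a , fsuc b , a<b) ∷ []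
  bags-slot {a} {b} a<b =
    trans (cong (uncurry triangle) (Fin.remQuot-combine (fsuc a) (fsuc b))) (triangle-contents a<b)

  in-slot : ∀ {a b} (a<b : fsuc a Fin.< fsuc b) {v} →
            v ∈ hub a ∷ hub b ∷ (fsuc a , fsuc b , a<b) ∷ [] → v ∈ bags (slot a<b)
  in-slot a<b = subst (_ ∈_) (sym (bags-slot a<b))

  cover : ∀ v → ∃ λ i → v ∈ bags i
  cover (_ , fzero , ())
  cover (fzero , fsuc c , s≤s z≤n) = fzero , ∈-tabulate⁺ c
  cover (fsuc a , fsuc b , a<b)    = slot a<b , in-slot a<b (there (there (here refl)))

  edges : ∀ {u v} → SubdivisionEdge u v → ∃ λ i → u ∈ bags i × v ∈ bags i
  edges (to-low  _ _ a<b) = slot a<b , in-slot a<b (there (there (here refl))) , in-slot a<b (here refl)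
  edges (to-high _ _ a<b) = slot a<b , in-slot a<b (there (there (here refl))) , in-slot a<b (there (here refl))

  triangle-determined : ∀ {a b p} xy → (fsuc a , b , p) ∈ uncurry triangle xy → xy ≡ (fsuc a , b)
  triangle-determined (fsuc x , fsuc y) m with fsuc x <? fsuc y
  triangle-determined (fsuc x , fsuc y) (there (there (here refl))) | yes _ = refl
  triangle-determined (fsuc x , fsuc y) (there (there (there ()))) | yes _

  leaves : ∀ {v} i j → v ∈ bags (fsuc i) → v ∈ bags (fsuc j) → v ∈ hubs ⊎ i ≡ j
  leaves {_ , fzero , ()}
  leaves {fzero , fsuc c , s≤s z≤n} _ _ _ _ = inj₁ (∈-tabulate⁺ c)
  leaves {fsuc a , b , p} i j v∈i v∈j = inj₂ (trans (slot-of i v∈i) (sym (slot-of j v∈j)))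
    where
    slot-of : ∀ k → (fsuc a , b , p) ∈ bags (fsuc k) → k ≡ combine (fsuc a) b
    slot-of k v∈k = trans (sym (Fin.combine-remQuot {suc n} (suc n) k))
                          (cong (uncurry combine) (triangle-determined (remQuot (suc n) k) v∈k))

  decomposition : TreeDecomposition (F₂ (Star n))
  decomposition = starDecomposition bags cover (subdivisionEdges-cover⇒edgeCover bags edges) leaves

  bag-size : n ≢ 2 → ∀ i → length (bag decomposition i) ≤ n
  bag-size _    fzero    = ℕ.≤-reflexive (length-tabulate hub)
  bag-size n≢2 (fsuc k) = triangle-size (remQuot (suc n) k)
    where
    triangle-size : ∀ ((x , y) : Fin (suc n) × Fin (suc n)) → length (triangle x y) ≤ n
    triangle-size (fsuc a , fsuc b) with fsuc a <? fsuc b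
    ... | yes a<b = ℕ.≤∧≢⇒< (ℕ.≤-trans (s≤s (ℕ.≤-trans (s≤s z≤n) (ℕ.s≤s⁻¹ a<b))) (Fin.toℕ<n b))
                            (λ 2≡n → n≢2 (sym 2≡n))
    ... | no  _   = z≤n
    triangle-size (fzero , _) = z≤n
    triangle-size (fsuc _ , fzero) = z≤n

module PathDecomposition where

  middle : Pair 3
  middle = fsuc fzero , fsuc (fsuc fzero) , s≤s (s≤s z≤n)

  bags : Fin 2 → List (Pair 3)
  bags fzero        = hub fzero ∷ middle ∷ []
  bags (fsuc fzero) = middle ∷ hub (fsuc fzero) ∷ []

  cover : ∀ v → ∃ λ i → v ∈ bags i
  cover (_ , fzero , ())
  cover (fzero , fsuc fzero , s≤s z≤n)                      = fzero , here refl
  cover (fzero , fsuc (fsuc fzero) , s≤s z≤n)               = fsuc fzero , there (here refl)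
  cover (fsuc fzero , fsuc (fsuc fzero) , s≤s (s≤s z≤n))    = fzero , there (here refl)
  cover (fsuc fzero , fsuc fzero , s≤s ())
  cover (fsuc (fsuc fzero) , fsuc fzero , s≤s ())
  cover (fsuc (fsuc fzero) , fsuc (fsuc fzero) , s≤s (s≤s ()))

  edges : ∀ {u v} → SubdivisionEdge u v → ∃ λ i → u ∈ bags i × v ∈ bags i
  edges (to-low  fzero (fsuc fzero) (s≤s (s≤s z≤n))) = fzero , there (here refl) , here refl
  edges (to-high fzero (fsuc fzero) (s≤s (s≤s z≤n))) = fsuc fzero , here refl , there (here refl)

  decomposition : TreeDecomposition (F₂ (Star 2))
  decomposition = starDecomposition bags cover (subdivisionEdges-cover⇒edgeCover bags edges)
                    (λ { fzero fzero _ _ → inj₂ refl })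

  bag-size : ∀ i → length (bag decomposition i) ≤ 2
  bag-size fzero        = ℕ.≤-refl
  bag-size (fsuc fzero) = ℕ.≤-refl

tw-F₂-star-≤ : ∀ n → ∃ λ (D : TreeDecomposition (F₂ (Star n))) → ∀ i → length (bag D i) ≤ n
tw-F₂-star-≤ n with n ℕ.≟ 2
... | yes refl = PathDecomposition.decomposition , PathDecomposition.bag-size
... | no  n≢2  = HubDecomposition.decomposition n , HubDecomposition.bag-size n n≢2

module _ {n} (D : TreeDecomposition (F₂ (Star n))) where

  Topped : Fin n → Node (tree D) → Set
  Topped i k = Any (λ v → larger v ≡ fsuc i) (bag D k)

  subdivisionEdge-covered : ∀ {u v} → SubdivisionEdge u v → ∃ λ c → u ∈ bag D c × v ∈ bag D c
  subdivisionEdge-covered e = edgeCover D _ _ (subdivisionEdge⇒tokAdj e)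

  shares-bag-with-hub : ∀ i v → larger v ≡ fsuc i → ∃ λ c → v ∈ bag D c × hub i ∈ bag D c
  shares-bag-with-hub i (_ , fzero , ()) _
  shares-bag-with-hub i (fzero , fsuc .i , s≤s z≤n) refl =
    let c , h∈c = vertexCover D (hub i) in c , h∈c , h∈c
  shares-bag-with-hub i (fsuc a , fsuc .i , a<i) refl = subdivisionEdge-covered (to-high a i a<i)

  topped-connected : ∀ i → IsConnected (tree D) (Topped i)
  topped-connected i a b a-topped b-topped with find a-topped | find b-topped
  ... | v₁ , v₁∈a , top₁ | v₂ , v₂∈b , top₂
    with shares-bag-with-hub i v₁ top₁ | shares-bag-with-hub i v₂ top₂
  ... | c₁ , v₁∈c₁ , h∈c₁ | c₂ , v₂∈c₂ , h∈c₂ =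
    walk-++ (within v₁ top₁ (connected D v₁ a c₁ v₁∈a v₁∈c₁))
   (walk-++ (within (hub i) refl (connected D (hub i) c₁ c₂ h∈c₁ h∈c₂))
            (within v₂ top₂ (connected D v₂ c₂ b v₂∈c₂ v₂∈b)))
    where
    within : ∀ v → larger v ≡ fsuc i → ∀ {x y} →
             WalkIn (tree D) (λ k → v ∈ bag D k) x y → WalkIn (tree D) (Topped i) x y
    within v top = walk-map (λ v∈ → lose v∈ top)

  topped-meet : ∀ i j → ∃ λ k → Topped i k × Topped j k
  topped-meet i j with Fin.<-cmp i j
  ... | tri≈ _ refl _ = let c , h∈c = vertexCover D (hub i) in c , lose h∈c refl , lose h∈c refl
  ... | tri< i<j _ _  = let c , v∈c , h∈c = subdivisionEdge-covered (to-low i j (s≤s i<j))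
                        in c , lose h∈c refl , lose v∈c refl
  ... | tri> _ _ j<i  = let c , v∈c , h∈c = subdivisionEdge-covered (to-low j i (s≤s j<i))
                        in c , lose v∈c refl , lose h∈c refl

  tw-F₂-star-≥ : ∃ λ t → n ≤ length (bag D t)
  tw-F₂-star-≥ =
    let t , topped-everywhere = helly (tree D) Topped (λ i k → any? (λ v → larger v ≟ fsuc i) (bag D k))
                                      topped-connected topped-meet
    in t , injection-into-list⇒≤length larger fsuc Fin.suc-injective topped-everywhere

mainTheorem3 : (n : ℕ) → 1 ≤ n → Treewidth≡ (F₂ (Star n)) (n ∸ 1)
mainTheorem3 (suc m) _ = tw-F₂-star-≤ (suc m) , tw-F₂-star-≥
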